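{- Let $\gamma$ be a real number with $0<\gamma<\frac{1}{2}$ and let $G$ be a graph with $n$ vertices and minimum degree at least $(1-\gamma)n$. For any two distinct edges $e$ and $e'$ of $G$ that share a vertex, we have \[\frac{1-2\gamma}{1-\gamma} \leqslant \frac{t_{e}}{t_{e'}} \leqslant \frac{1-\gamma}{1-2\gamma}.\]
   Context: For an edge $xy$ of a graph $G$, $t_{xy}$ denotes the number of vertices in $V(G)\setminus\{x,y\}$ adjacent to both $x$ and $y$.
   Formalization: The parameter γ ranges over rational numbers with $0<\gamma<\frac{1}{2}$ rather than over real numbers. -}

module Defs where

open import Data.Bool using (Bool; true; false; _∧_; not; T)
open import Data.Nat using (ℕ)
open import Data.Fin using (Fin)
open import Data.Fin.Properties using () renaming (_≟_ to _≟ᶠ_)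
open import Data.List using (List; length; filterᵇ)
open import Data.List.Base using (allFin)
open import Data.Integer using (+_)
open import Data.Rational using (ℚ; _/_; _÷_; 0ℚ; ≢-nonZero)
open import Data.Rational.Properties using () renaming (_≟_ to _≟ℚ_)
open import Relation.Nullary using (yes; no)
open import Relation.Nullary.Decidable using (⌊_⌋)
open import Relation.Binary.PropositionalEquality using (_≡_)

record SimpleGraph (n : ℕ) : Set where
  field
    adj    : Fin n → Fin n → Bool
    sym    : ∀ u v → adj u v ≡ adj v u
    irrefl : ∀ v → adj v v ≡ false

open SimpleGraph public

Adj : ∀ {n} → SimpleGraph n → Fin n → Fin n → Set
Adj G u v = T (adj G u v)

deg : ∀ {n} → SimpleGraph n → Fin n → ℕ
deg {n} G v = length (filterᵇ (adj G v) (allFin n))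

t : ∀ {n} → SimpleGraph n → Fin n → Fin n → ℕ
t {n} G x y = length (filterᵇ
  (λ z → adj G x z ∧ adj G y z ∧ not ⌊ z ≟ᶠ x ⌋ ∧ not ⌊ z ≟ᶠ y ⌋)
  (allFin n))

ℕtoℚ : ℕ → ℚ
ℕtoℚ k = (+ k) / 1

-- division of rationals, a / b; total by the convention a / 0 = 0
-- (only ever applied below to denominators that are positive under the hypotheses)
_÷₀_ : ℚ → ℚ → ℚ
a ÷₀ b with b ≟ℚ 0ℚ
... | yes _  = 0ℚ
... | no b≢0 = _÷_ a b {{≢-nonZero b≢0}}

{-# OPTIONS --safe #-}
module Submission where

-- Since y is a neighbour of x but not of itself, t_{xy} < deg x. Inclusion–exclusion on the
-- neighbourhoods of x and z gives t_{xz} ≥ deg x + deg z − n ≥ deg x − γn, and since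
-- (1 − γ)n ≤ deg x this is at least deg x · (1 − 2γ)/(1 − γ). Hence
-- t_{xy}(1 − 2γ) < t_{xz}(1 − γ) for any two edges xy and xz at x; swapping y and z gives
-- the other bound, and taking y = z shows t_{xz} > 0.

open import Defs hiding (sym)
open import Data.Bool using (Bool; true; false; _∧_; _∨_; not; T)
open import Data.Bool.Properties using (∧-identityʳ; T?)
open import Data.Fin using (Fin)
open import Data.Fin.Properties using () renaming (_≟_ to _≟ᶠ_)
open import Data.Integer as ℤ using (+_)
import Data.Integer.Properties as ℤ
open import Data.List using (List; []; _∷_; length; filterᵇ; allFin)
open import Data.List.Properties using (length-filter; filter-notAll; filter-≐; length-tabulate)
open import Data.List.Membership.Propositional using (_∈_; lose)
open import Data.List.Membership.Propositional.Properties using (∈-filter⁺; ∈-allFin)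
open import Data.Nat as ℕ using (ℕ; suc)
import Data.Nat.Properties as ℕ
open import Data.Nat.Coprimality using (1-coprimeTo) renaming (sym to coprime-sym)
open import Data.Product using (_×_; _,_)
open import Data.Rational using (ℚ; mkℚ; _≤_; _<_; _+_; _-_; _*_; -_; 1/_; 0ℚ; 1ℚ; ½; *≤*; *<*; Positive; NonNegative; NonZero; ≢-nonZero; positive; nonNegative)
open import Data.Rational.Properties
  using ( _≟_; module ≤-Reasoning; normalize-coprime; /-cong; +-*-commutativeRing
        ; <⇒≤; <-irrefl; <-trans; <-≤-trans; +-mono-<; +-monoˡ-≤; +-monoʳ-≤; +-monoˡ-<
        ; +-inverseʳ; neg-antimono-≤; *-assoc; *-comm; *-identityʳ; *-zeroˡ; *-inverseˡ
        ; *-monoˡ-≤-nonNeg; *-monoʳ-≤-nonNeg; *-monoˡ-<-pos; pos*pos⇒pos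
        ; *-cancelʳ-≤-pos; *-cancelʳ-<-nonNeg )
open import Function using (_∘_; id)
open import Level using (0ℓ)
open import Relation.Nullary using (¬_; yes; no; contradiction)
open import Relation.Nullary.Decidable using (⌊_⌋; dec⇒maybe)
open import Relation.Binary.PropositionalEquality
import Tactic.RingSolver.Core.AlmostCommutativeRing as ACR
open import Tactic.RingSolver using (solve)

module _ {A : Set} where

  count : (A → Bool) → List A → ℕ
  count P xs = length (filterᵇ P xs)

  filterᵇ-cong : ∀ {P Q : A → Bool} → P ≗ Q → filterᵇ P ≗ filterᵇ Q
  filterᵇ-cong {P} {Q} P≗Q =
    filter-≐ (T? ∘ P) (T? ∘ Q) ((λ {v} → subst T (P≗Q v)) , (λ {v} → subst T (sym (P≗Q v))))

  module _ (P Q : A → Bool) where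

    filterᵇ-∧ : ∀ xs → filterᵇ (λ v → P v ∧ Q v) xs ≡ filterᵇ Q (filterᵇ P xs)
    filterᵇ-∧ [] = refl
    filterᵇ-∧ (x ∷ xs) with P x
    ... | false = filterᵇ-∧ xs
    ... | true with Q x
    ...   | true  = cong (x ∷_) (filterᵇ-∧ xs)
    ...   | false = filterᵇ-∧ xs

    count-∧-< : ∀ {y} xs → y ∈ xs → T (P y) → ¬ T (Q y) →
                count (λ v → P v ∧ Q v) xs ℕ.< count P xs
    count-∧-< xs y∈xs Py ¬Qy rewrite filterᵇ-∧ xs =
      filter-notAll (T? ∘ Q) (filterᵇ P xs) (lose (∈-filter⁺ (T? ∘ P) y∈xs Py) ¬Qy)

    count+count≡count-∨+count-∧ : ∀ xs → count P xs ℕ.+ count Q xs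
                         ≡ count (λ v → P v ∨ Q v) xs ℕ.+ count (λ v → P v ∧ Q v) xs
    count+count≡count-∨+count-∧ [] = refl
    count+count≡count-∨+count-∧ (x ∷ xs) with P x
    ... | true with Q x
    ...   | true  = cong suc (trans (ℕ.+-suc _ _)
                      (trans (cong suc (count+count≡count-∨+count-∧ xs)) (sym (ℕ.+-suc _ _))))
    ...   | false = cong suc (count+count≡count-∨+count-∧ xs)
    count+count≡count-∨+count-∧ (x ∷ xs) | false with Q x
    ...   | true  = trans (ℕ.+-suc _ _) (cong suc (count+count≡count-∨+count-∧ xs))
    ...   | false = count+count≡count-∨+count-∧ xs

    count+count≤length+count-∧ : ∀ xs → count P xs ℕ.+ count Q xs
                           ℕ.≤ length xs ℕ.+ count (λ v → P v ∧ Q v) xs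
    count+count≤length+count-∧ xs rewrite count+count≡count-∨+count-∧ xs =
      ℕ.+-monoˡ-≤ _ (length-filter (T? ∘ λ v → P v ∨ Q v) xs)

module _ {n : ℕ} (G : SimpleGraph n) where

  adj∧adj-excludes-ends : ∀ x y v →
    (adj G x v ∧ adj G y v ∧ not ⌊ v ≟ᶠ x ⌋ ∧ not ⌊ v ≟ᶠ y ⌋) ≡ (adj G x v ∧ adj G y v)
  adj∧adj-excludes-ends x y v with v ≟ᶠ x | v ≟ᶠ y
  ... | yes refl | _        rewrite irrefl G v = refl
  ... | no _     | yes refl rewrite irrefl G v = refl
  ... | no _     | no _     = cong (adj G x v ∧_) (∧-identityʳ (adj G y v))

  t≡count-adj∧adj : ∀ x y → t G x y ≡ count (λ v → adj G x v ∧ adj G y v) (allFin n)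
  t≡count-adj∧adj x y = cong length (filterᵇ-cong (adj∧adj-excludes-ends x y) (allFin n))

  t<deg : ∀ {x y} → Adj G x y → t G x y ℕ.< deg G x
  t<deg {x} {y} xy rewrite t≡count-adj∧adj x y =
    count-∧-< (adj G x) (adj G y) (allFin n) (∈-allFin y) xy (subst T (irrefl G y))

  deg+deg≤n+t : ∀ x z → deg G x ℕ.+ deg G z ℕ.≤ n ℕ.+ t G x z
  deg+deg≤n+t x z = begin
    deg G x ℕ.+ deg G z
      ≤⟨ count+count≤length+count-∧ (adj G x) (adj G z) (allFin n) ⟩
    length (allFin n) ℕ.+ count (λ v → adj G x v ∧ adj G z v) (allFin n)
      ≡⟨ cong₂ ℕ._+_ (length-tabulate id) (sym (t≡count-adj∧adj x z)) ⟩
    n ℕ.+ t G x z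
      ∎
    where open ℕ.≤-Reasoning

ℕtoℚ≡mkℚ : ∀ k → ℕtoℚ k ≡ mkℚ (+ k) 0 (coprime-sym (1-coprimeTo k))
ℕtoℚ≡mkℚ k = normalize-coprime (coprime-sym (1-coprimeTo k))

ℕtoℚ-mono-≤ : ∀ {j k} → j ℕ.≤ k → ℕtoℚ j ≤ ℕtoℚ k
ℕtoℚ-mono-≤ {j} {k} j≤k rewrite ℕtoℚ≡mkℚ j | ℕtoℚ≡mkℚ k =
  *≤* (subst₂ ℤ._≤_ (sym (ℤ.*-identityʳ (+ j))) (sym (ℤ.*-identityʳ (+ k))) (ℤ.+≤+ j≤k))

ℕtoℚ-mono-< : ∀ {j k} → j ℕ.< k → ℕtoℚ j < ℕtoℚ k
ℕtoℚ-mono-< {j} {k} j<k rewrite ℕtoℚ≡mkℚ j | ℕtoℚ≡mkℚ k =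
  *<* (subst₂ ℤ._<_ (sym (ℤ.*-identityʳ (+ j))) (sym (ℤ.*-identityʳ (+ k))) (ℤ.+<+ j<k))

ℕtoℚ-homo-+ : ∀ j k → ℕtoℚ (j ℕ.+ k) ≡ ℕtoℚ j + ℕtoℚ k
ℕtoℚ-homo-+ j k rewrite ℕtoℚ≡mkℚ j | ℕtoℚ≡mkℚ k =
  /-cong (sym (cong₂ ℤ._+_ (ℤ.*-identityʳ (+ j)) (ℤ.*-identityʳ (+ k)))) refl

p≤q⇒0≤q-p : ∀ {p q} → p ≤ q → 0ℚ ≤ q - p
p≤q⇒0≤q-p {p} {q} p≤q = subst (_≤ q - p) (+-inverseʳ p) (+-monoˡ-≤ (- p) p≤q)

p<q⇒0<q-p : ∀ {p q} → p < q → 0ℚ < q - p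
p<q⇒0<q-p {p} {q} p<q = subst (_< q - p) (+-inverseʳ p) (+-monoˡ-< (- p) p<q)

½<1 : ½ < 1ℚ
½<1 = *<* (ℤ.+<+ (ℕ.s≤s (ℕ.s≤s ℕ.z≤n)))

-- The zero test lets the solver discard monomials whose coefficients cancel.
ℚ-ring : ACR.AlmostCommutativeRing 0ℓ 0ℓ
ℚ-ring = ACR.fromCommutativeRing +-*-commutativeRing (λ q → dec⇒maybe (0ℚ ≟ q))

D*[1-2γ]≤b*[1-γ] : ∀ {γ n D d b} → 0ℚ ≤ γ → γ ≤ 1ℚ →
                   (1ℚ - γ) * n ≤ D → (1ℚ - γ) * n ≤ d → D + d ≤ n + b →
                   D * (1ℚ - (γ + γ)) ≤ b * (1ℚ - γ)
D*[1-2γ]≤b*[1-γ] {γ} {n} {D} {d} {b} 0≤γ γ≤1 D≥ d≥ D+d≤n+b = begin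
  D * (1ℚ - (γ + γ))                  ≡⟨ solve (γ ∷ D ∷ []) ℚ-ring ⟩
  D * (1ℚ - γ) - γ * D                ≤⟨ +-monoʳ-≤ (D * (1ℚ - γ)) (neg-antimono-≤ (*-monoˡ-≤-nonNeg γ D≥)) ⟩
  D * (1ℚ - γ) - γ * ((1ℚ - γ) * n)   ≡⟨ solve (γ ∷ n ∷ D ∷ []) ℚ-ring ⟩
  (D + (1ℚ - γ) * n - n) * (1ℚ - γ)   ≤⟨ *-monoʳ-≤-nonNeg (1ℚ - γ) (+-monoˡ-≤ (- n) (+-monoʳ-≤ D d≥)) ⟩
  (D + d - n) * (1ℚ - γ)              ≤⟨ *-monoʳ-≤-nonNeg (1ℚ - γ) (+-monoˡ-≤ (- n) D+d≤n+b) ⟩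
  (n + b - n) * (1ℚ - γ)              ≡⟨ solve (γ ∷ n ∷ b ∷ []) ℚ-ring ⟩
  b * (1ℚ - γ)                        ∎
  where
  open ≤-Reasoning
  instance
    _ : NonNegative γ
    _ = nonNegative 0≤γ
    _ : NonNegative (1ℚ - γ)
    _ = nonNegative (p≤q⇒0≤q-p γ≤1)

÷₀-*-cancel : ∀ p {q} → 0ℚ < q → (p ÷₀ q) * q ≡ p
÷₀-*-cancel p {q} 0<q with q ≟ 0ℚ
... | yes q≡0 = contradiction 0<q (<-irrefl (sym q≡0))
... | no q≢0 = begin
  p * (1/ q) * q   ≡⟨ *-assoc p (1/ q) q ⟩
  p * ((1/ q) * q) ≡⟨ cong (p *_) (*-inverseˡ q) ⟩
  p * 1ℚ           ≡⟨ *-identityʳ p ⟩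
  p                ∎
  where
  open ≡-Reasoning
  instance
    _ : NonZero q
    _ = ≢-nonZero q≢0

p*s≤r*q⇒p÷₀q≤r÷₀s : ∀ {p q r s} → 0ℚ < q → 0ℚ < s → p * s ≤ r * q → p ÷₀ q ≤ r ÷₀ s
p*s≤r*q⇒p÷₀q≤r÷₀s {p} {q} {r} {s} 0<q 0<s ps≤rq = *-cancelʳ-≤-pos (q * s) (begin
  (p ÷₀ q) * (q * s)  ≡⟨ *-assoc (p ÷₀ q) q s ⟨
  (p ÷₀ q) * q * s    ≡⟨ cong (_* s) (÷₀-*-cancel p 0<q) ⟩
  p * s               ≤⟨ ps≤rq ⟩
  r * q               ≡⟨ cong (_* q) (÷₀-*-cancel r 0<s) ⟨
  (r ÷₀ s) * s * q    ≡⟨ *-assoc (r ÷₀ s) s q ⟩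
  (r ÷₀ s) * (s * q)  ≡⟨ cong ((r ÷₀ s) *_) (*-comm s q) ⟩
  (r ÷₀ s) * (q * s)  ∎)
  where
  open ≤-Reasoning
  instance
    _ : Positive (q * s)
    _ = pos*pos⇒pos q {{positive 0<q}} s {{positive 0<s}}

module MinDegree {γ : ℚ} (0≤γ : 0ℚ ≤ γ) (γ<½ : γ < ½) {n : ℕ} (G : SimpleGraph n)
                 (min-deg : ∀ v → (1ℚ - γ) * ℕtoℚ n ≤ ℕtoℚ (deg G v)) where

  γ<1 : γ < 1ℚ
  γ<1 = <-trans γ<½ ½<1

  0<1-γ : 0ℚ < 1ℚ - γ
  0<1-γ = p<q⇒0<q-p γ<1

  0<1-2γ : 0ℚ < 1ℚ - (γ + γ)
  0<1-2γ = p<q⇒0<q-p (+-mono-< γ<½ γ<½)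

  deg*[1-2γ]≤t*[1-γ] : ∀ x z → ℕtoℚ (deg G x) * (1ℚ - (γ + γ)) ≤ ℕtoℚ (t G x z) * (1ℚ - γ)
  deg*[1-2γ]≤t*[1-γ] x z =
    D*[1-2γ]≤b*[1-γ] {d = ℕtoℚ (deg G z)} {b = ℕtoℚ (t G x z)}
      0≤γ (<⇒≤ γ<1) (min-deg x) (min-deg z)
      (subst₂ _≤_ (ℕtoℚ-homo-+ (deg G x) (deg G z)) (ℕtoℚ-homo-+ n (t G x z))
                  (ℕtoℚ-mono-≤ (deg+deg≤n+t G x z)))

  t*[1-2γ]<t*[1-γ] : ∀ {x y} z → Adj G x y →
                     ℕtoℚ (t G x y) * (1ℚ - (γ + γ)) < ℕtoℚ (t G x z) * (1ℚ - γ)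
  t*[1-2γ]<t*[1-γ] {x} z xy =
    <-≤-trans (*-monoˡ-<-pos (1ℚ - (γ + γ)) {{positive 0<1-2γ}} (ℕtoℚ-mono-< (t<deg G xy)))
              (deg*[1-2γ]≤t*[1-γ] x z)

  t>0 : ∀ {x z} → Adj G x z → 0ℚ < ℕtoℚ (t G x z)
  t>0 {x} {z} xz = *-cancelʳ-<-nonNeg (1ℚ - γ) (begin-strict
    0ℚ * (1ℚ - γ)                   ≡⟨ *-zeroˡ (1ℚ - γ) ⟩
    0ℚ                              ≡⟨ *-zeroˡ (1ℚ - (γ + γ)) ⟨
    0ℚ * (1ℚ - (γ + γ))             ≤⟨ *-monoʳ-≤-nonNeg (1ℚ - (γ + γ)) (ℕtoℚ-mono-≤ {k = t G x z} ℕ.z≤n) ⟩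
    ℕtoℚ (t G x z) * (1ℚ - (γ + γ)) <⟨ t*[1-2γ]<t*[1-γ] z xz ⟩
    ℕtoℚ (t G x z) * (1ℚ - γ)       ∎)
    where
    open ≤-Reasoning
    instance
      _ : NonNegative (1ℚ - γ)
      _ = nonNegative (<⇒≤ 0<1-γ)
      _ : NonNegative (1ℚ - (γ + γ))
      _ = nonNegative (<⇒≤ 0<1-2γ)

lemma3p4 : (γ : ℚ) → 0ℚ < γ → γ < ½ →
    (n : ℕ) (G : SimpleGraph n) →
    (∀ v → (1ℚ - γ) * ℕtoℚ n ≤ ℕtoℚ (deg G v)) →
    (x y z : Fin n) → Adj G x y → Adj G x z → y ≢ z →
    (0ℚ < ℕtoℚ (t G x z))
    × ((1ℚ - (γ + γ)) ÷₀ (1ℚ - γ) ≤ ℕtoℚ (t G x y) ÷₀ ℕtoℚ (t G x z))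
    × (ℕtoℚ (t G x y) ÷₀ ℕtoℚ (t G x z) ≤ (1ℚ - γ) ÷₀ (1ℚ - (γ + γ)))
lemma3p4 γ 0<γ γ<½ n G min-deg x y z xy xz _ = t>0 xz , lower , upper
  where
  open MinDegree (<⇒≤ 0<γ) γ<½ G min-deg
  lower : (1ℚ - (γ + γ)) ÷₀ (1ℚ - γ) ≤ ℕtoℚ (t G x y) ÷₀ ℕtoℚ (t G x z)
  lower = p*s≤r*q⇒p÷₀q≤r÷₀s 0<1-γ (t>0 xz)
    (subst (_≤ _) (*-comm (ℕtoℚ (t G x z)) (1ℚ - (γ + γ))) (<⇒≤ (t*[1-2γ]<t*[1-γ] y xz)))
  upper : ℕtoℚ (t G x y) ÷₀ ℕtoℚ (t G x z) ≤ (1ℚ - γ) ÷₀ (1ℚ - (γ + γ))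
  upper = p*s≤r*q⇒p÷₀q≤r÷₀s (t>0 xz) 0<1-2γ
    (subst (_ ≤_) (*-comm (ℕtoℚ (t G x z)) (1ℚ - γ)) (<⇒≤ (t*[1-2γ]<t*[1-γ] z xy)))
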